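{- Let $\pi$ be a permutation of $[n]$ containing exactly one occurrence of the pattern $132$, and let $a,c,b$ be the letters of this occurrence (so $a<b<c$ and $a$ appears before $c$, which appears before $b$). Then $a$ and $c$ occupy consecutive positions in $\pi$, and $b=a+1$.
   Context: An occurrence of $132$ in a permutation $\pi_1\cdots\pi_n$ is a triple of positions $i<j<k$ with $\pi_i<\pi_k<\pi_j$. -}

module Defs where

open import Data.Fin using (Fin; _<_)
open import Data.Fin.Permutation using (Permutation′; _⟨$⟩ʳ_)
open import Data.Product using (_×_)
open import Relation.Binary.PropositionalEquality using (_≡_)

-- A permutation π of [n] is a bijection Fin n → Fin n; π ⟨$⟩ʳ i is the
-- letter at position i (positions and letters are 0-indexed).

Occ132 : ∀ {n} → Permutation′ n → Fin n → Fin n → Fin n → Set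
Occ132 π i j k =
  (i < j) × (j < k) × ((π ⟨$⟩ʳ i) < (π ⟨$⟩ʳ k)) × ((π ⟨$⟩ʳ k) < (π ⟨$⟩ʳ j))

UniqueOcc132 : ∀ {n} → Permutation′ n → Fin n → Fin n → Fin n → Set
UniqueOcc132 π i j k =
  Occ132 π i j k ×
  (∀ i′ j′ k′ → Occ132 π i′ j′ k′ → (i′ ≡ i) × (j′ ≡ j) × (k′ ≡ k))

-- Both claims say that no position, resp. no letter, lies strictly inside the
-- relevant interval of the occurrence: any such m would form a second
-- occurrence (m , j , k), (i , m , k) or (i , j , m).

module Submission where

open import Defs
open import Data.Nat using (ℕ; suc)
open import Data.Fin using (Fin; toℕ)
open import Data.Fin.Permutation using (Permutation′; _⟨$⟩ʳ_)
open import Data.Product using (_×_)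
open import Relation.Binary.PropositionalEquality using (_≡_)

open import Data.Empty using (⊥; ⊥-elim)
open import Data.Product using (_,_; proj₁; proj₂)
open import Relation.Nullary using (yes; no)
open import Relation.Binary using (tri<; tri≈; tri>)
open import Relation.Binary.PropositionalEquality using (refl; sym; trans; cong; subst)
import Data.Nat as ℕ
import Data.Nat.Properties as ℕ
open import Data.Fin using (_<_; fromℕ<)
open import Data.Fin.Properties using (toℕ-fromℕ<; toℕ<n; <-cmp; <-irrefl; <-trans; <-asym)
open import Data.Fin.Permutation using (_⟨$⟩ˡ_; inverseˡ; inverseʳ)

nothing-between⇒toℕ-suc : ∀ {n} {x y : Fin n} → x < y →
                          (∀ z → x < z → z < y → ⊥) → toℕ y ≡ suc (toℕ x)
nothing-between⇒toℕ-suc {x = x} {y} x<y nothing-between with suc (toℕ x) ℕ.<? toℕ y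
... | no  x+1≮y = ℕ.≤-antisym (ℕ.≮⇒≥ x+1≮y) x<y
... | yes x+1<y = ⊥-elim (nothing-between z x<z z<y)
  where
  z : Fin _
  z = fromℕ< (ℕ.<-trans x+1<y (toℕ<n y))
  z≡x+1 : toℕ z ≡ suc (toℕ x)
  z≡x+1 = toℕ-fromℕ< (ℕ.<-trans x+1<y (toℕ<n y))
  x<z : x < z
  x<z = ℕ.≤-reflexive (sym z≡x+1)
  z<y : z < y
  z<y = subst (ℕ._< toℕ y) (sym z≡x+1) x+1<y

⟨$⟩ʳ-injective : ∀ {n} (π : Permutation′ n) {x y : Fin n} →
                 π ⟨$⟩ʳ x ≡ π ⟨$⟩ʳ y → x ≡ y
⟨$⟩ʳ-injective π πx≡πy =
  trans (sym (inverseˡ π)) (trans (cong (π ⟨$⟩ˡ_) πx≡πy) (inverseˡ π))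

module UniqueOccurrence {n} (π : Permutation′ n) (i j k : Fin n)
                        (unique : UniqueOcc132 π i j k) where

  private
    i<j : i < j
    i<j = proj₁ (proj₁ unique)
    j<k : j < k
    j<k = proj₁ (proj₂ (proj₁ unique))
    πi<πk : π ⟨$⟩ʳ i < π ⟨$⟩ʳ k
    πi<πk = proj₁ (proj₂ (proj₂ (proj₁ unique)))
    πk<πj : π ⟨$⟩ʳ k < π ⟨$⟩ʳ j
    πk<πj = proj₂ (proj₂ (proj₂ (proj₁ unique)))
    only : ∀ i′ j′ k′ → Occ132 π i′ j′ k′ → (i′ ≡ i) × (j′ ≡ j) × (k′ ≡ k)
    only = proj₂ unique

  no-position-between : ∀ m → i < m → m < j → ⊥
  no-position-between m i<m m<j with <-cmp (π ⟨$⟩ʳ m) (π ⟨$⟩ʳ k)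
  ... | tri< πm<πk _ _ = <-irrefl (sym (proj₁ (only m j k occ))) i<m
    where
    occ : Occ132 π m j k
    occ = m<j , j<k , πm<πk , πk<πj
  ... | tri≈ _ πm≡πk _ = <-irrefl (⟨$⟩ʳ-injective π πm≡πk) (<-trans m<j j<k)
  ... | tri> _ _ πk<πm = <-irrefl (proj₁ (proj₂ (only i m k occ))) m<j
    where
    occ : Occ132 π i m k
    occ = i<m , <-trans m<j j<k , πi<πk , πk<πm

  no-letter-between : ∀ m → π ⟨$⟩ʳ i < π ⟨$⟩ʳ m → π ⟨$⟩ʳ m < π ⟨$⟩ʳ k → ⊥
  no-letter-between m πi<πm πm<πk with <-cmp m j
  ... | tri< m<j _ _ = <-irrefl (cong (π ⟨$⟩ʳ_) (sym (proj₁ (only m j k occ)))) πi<πm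
    where
    occ : Occ132 π m j k
    occ = m<j , j<k , πm<πk , πk<πj
  ... | tri≈ _ refl _ = <-asym πm<πk πk<πj
  ... | tri> _ _ j<m = <-irrefl (cong (π ⟨$⟩ʳ_) (proj₂ (proj₂ (only i j m occ)))) πm<πk
    where
    occ : Occ132 π i j m
    occ = i<j , j<m , πi<πm , <-trans πm<πk πk<πj

lemma16 : (n : ℕ) (π : Permutation′ n) (i j k : Fin n) →
          UniqueOcc132 π i j k →
          (toℕ j ≡ suc (toℕ i)) × (toℕ (π ⟨$⟩ʳ k) ≡ suc (toℕ (π ⟨$⟩ʳ i)))
lemma16 n π i j k unique@((i<j , _ , πi<πk , _) , _) =
  nothing-between⇒toℕ-suc i<j no-position-between ,
  nothing-between⇒toℕ-suc πi<πk no-value-between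
  where
  open UniqueOccurrence π i j k unique
  no-value-between : ∀ d → π ⟨$⟩ʳ i < d → d < π ⟨$⟩ʳ k → ⊥
  no-value-between d πi<d d<πk =
    no-letter-between (π ⟨$⟩ˡ d)
      (subst (π ⟨$⟩ʳ i <_) (sym (inverseʳ π)) πi<d)
      (subst (_< π ⟨$⟩ʳ k) (sym (inverseʳ π)) d<πk)
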